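{- Let $m\ge 2$ be an integer and let $k\ge 5$ be odd. Suppose $P^{ - }(m)\ge (k+2)/2$, where $P^{ - }(m)$ is the least prime factor of $m$. Let \[ D=\Bigl\{0,1,\dots,\Bigl\lfloor \tfrac{k-1}{k+1}m\Bigr\rfloor\Bigr\}\subseteq \mathbb{Z}_m, \] and let $n$ be a positive integer divisible by $\lfloor \frac{k-1}{k+1}m\rfloor+1$. Then $S(D,n)$ contains no arithmetic progression of length $k$.
   Context: $\mathbb{Z}_m=\mathbb{Z}/m\mathbb{Z}$. For a set $D=\{d_1,\dots,d_{|D|}\}\subseteq\mathbb{Z}_m$ and a positive integer $n$ with $|D|\mid n$, define \[ S(D,n)=\{(v_1,\dots,v_n)\in\mathbb{Z}_m^n : \text{for each } i\le |D|,\ v_j=d_i \text{ for exactly } n/|D| \text{ indices } j\}, \] i.e. the vectors all of whose coordinates lie in $D$ and in which every element of $D$ occurs equally often. An arithmetic progression of length $k$ in $\mathbb{Z}_m^n$ is a sequence $\mathbf{v},\mathbf{v}+\mathbf{c},\dots,\mathbf{v}+(k-1)\mathbf{c}$ with $\mathbf{c}\neq 0$. -}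

module Defs where

open import Data.Nat using (ℕ; zero; suc; _+_; _*_; _∸_; _≤_; _<_; NonZero)
open import Data.Nat.DivMod using (_/_; _%_; m%n<n)
open import Data.Fin using (Fin; toℕ; fromℕ<)
open import Data.Fin.Properties using (_≟_)
open import Data.List using (List; length; filter)
open import Data.List.Base using (allFin)
open import Relation.Binary.PropositionalEquality using (_≡_)
open import Relation.Nullary using (¬_)
open import Data.Product using (∃)

_+ₘ_ : ∀ {m} .{{_ : NonZero m}} → Fin m → Fin m → Fin m
_+ₘ_ {m} a b = fromℕ< (m%n<n (toℕ a + toℕ b) m)

_·ₘ_ : ∀ {m} .{{_ : NonZero m}} → ℕ → Fin m → Fin m
_·ₘ_ {m} i c = fromℕ< (m%n<n (i * toℕ c) m)

Vecₘ : ℕ → ℕ → Set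
Vecₘ m n = Fin n → Fin m

_⊕_ : ∀ {m n} .{{_ : NonZero m}} → Vecₘ m n → Vecₘ m n → Vecₘ m n
(u ⊕ w) j = u j +ₘ w j

_⊙_ : ∀ {m n} .{{_ : NonZero m}} → ℕ → Vecₘ m n → Vecₘ m n
(i ⊙ w) j = i ·ₘ w j

IsZeroVec : ∀ {m n} → Vecₘ m n → Set
IsZeroVec {n = n} c = ∀ (j : Fin n) → toℕ (c j) ≡ 0

count : ∀ {m n} → Vecₘ m n → Fin m → ℕ
count {n = n} v d = length (filter (λ j → v j ≟ d) (allFin n))

-- A subset D of ℤ_m given by a predicate, with its cardinality |D| (passed explicitly).
-- S(D,n) : all coordinates lie in D, each element of D occurs exactly n/|D| times.
InS : ∀ {m n} (D : Fin m → Set) (cardD : ℕ) .{{_ : NonZero cardD}} → Vecₘ m n → Set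
InS {m} {n} D cardD v =
  (∀ (j : Fin n) → D (v j)) × (∀ (d : Fin m) → D d → count v d ≡ n / cardD)
  where open import Data.Product using (_×_)

HasAP : ∀ {m n} .{{_ : NonZero m}} (D : Fin m → Set) (cardD : ℕ) .{{_ : NonZero cardD}} → ℕ → Set
HasAP {m} {n} D cardD k =
  ∃ λ (v : Vecₘ m n) → ∃ λ (c : Vecₘ m n) →
    (¬ IsZeroVec c) × (∀ i → i < k → InS D cardD (v ⊕ (i ⊙ c)))
  where open import Data.Product using (_×_)

bound : ℕ → ℕ → ℕ
bound k m = ((k ∸ 1) * m) / suc k

Dset : ∀ {m} → ℕ → Fin m → Set
Dset {m} k x = toℕ x ≤ bound k m

{-# OPTIONS --safe #-}
module Submission where

-- Write k = 2h + 1, B = ⌊2hm/(2h + 2)⌋ and G = m − B, so that D = [0, B]. Every divisor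
-- d ≥ 2 of m exceeds h + 1, hence h + 1 ∤ m, which sharpens (h + 1)B ≤ hm to B < hG.
-- Suppose the rows v + ic (i < k) all lie in S(D, n) with c ≠ 0, and let d be the largest
-- value taken by a row in a column where c is nonzero. Every row contains d equally often
-- and the rows agree wherever c vanishes, so d occurs in the middle row h in a column with a
-- step γ ≠ 0. There the middle term is the largest of the 2h + 1 terms and lies in [0, B],
-- so every step eγ mod m with 1 ≤ e ≤ h lies in [G, B]: a smaller nonzero one would make
-- term h + e larger, a larger one term h − e. But the h + 1 residues 0, γ, …, hγ lie in
-- [0, B], which is covered by h intervals of width G, and the difference of two residues in
-- the same interval lies outside [G, B].

open import Defs
open import Data.Nat using (ℕ; zero; suc; _+_; _*_; _∸_; _≤_; _<_; _≟_; NonZero; z≤n; s≤s; z<s; s<s; s≤s⁻¹; >-nonZero; >-nonZero⁻¹; ≢-nonZero⁻¹; n>1⇒nonTrivial)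
open import Data.Nat.Properties hiding (_≟_)
open import Data.Nat.DivMod
open import Data.Nat.Divisibility using (_∣_; _∣?_; divides; ∣⇒≤; 0∣⇒≡0; m%n≡0⇒n∣m)
open import Data.Nat.Divisibility.Core using (hasNonTrivialDivisor)
open import Data.Nat.Primality using (Prime; _Rough_; 0-rough; 1-rough; 2-rough; ∤⇒rough-suc; rough∧∣⇒prime)
open import Data.Nat.Coprimality using (Coprime; coprime-divisor)
open import Data.Fin as Fin using (Fin; toℕ; fromℕ<)
open import Data.Fin.Properties using (toℕ-fromℕ<; toℕ<n; toℕ-injective; pigeonhole)
open import Data.List using ([]; _∷_; length; filter; allFin)
open import Data.List.Relation.Unary.Any using (Any; here; there)
open import Data.List.Membership.Propositional using (lose)
open import Data.List.Membership.Propositional.Properties using (∈-allFin)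
open import Data.Product using (∃₂; _×_; _,_; proj₁; proj₂)
open import Data.Sum using (_⊎_; inj₁; inj₂)
open import Data.Empty using (⊥)
open import Level using (0ℓ)
open import Relation.Nullary using (¬_; yes; no; contradiction)
open import Relation.Unary using (Pred; Decidable; _⊆_)
open import Relation.Binary.PropositionalEquality

m<o⇒n<o⇒m+n<2*o : ∀ {m n o} → m < o → n < o → m + n < 2 * o
m<o⇒n<o⇒m+n<2*o {m} {n} {o} m<o n<o = subst (m + n <_) (cong (o +_) (sym (+-identityʳ o))) (+-mono-< m<o n<o)

module _ {m : ℕ} .{{_ : NonZero m}} where

  +-%-cases : ∀ {x y z} → x < m → y < m → (x + y) % m ≡ z → x + y ≡ z ⊎ x + y ≡ z + m
  +-%-cases {x} {y} x<m y<m refl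
    with (x + y) / m | m≡m%n+[m/n]*n (x + y) m | m<n*o⇒m/o<n {x + y} {2} {m} (m<o⇒n<o⇒m+n<2*o x<m y<m)
  ... | 0 | x+y≡r+0 | _ = inj₁ (trans x+y≡r+0 (+-identityʳ _))
  ... | 1 | x+y≡r+m | _ = inj₂ (trans x+y≡r+m (cong ((x + y) % m +_) (*-identityˡ m)))
  ... | suc (suc _) | _ | s<s (s<s ())

  %-progression-step : ∀ a i e γ → ((a + i * γ) % m + (e * γ) % m) % m ≡ (a + (i + e) * γ) % m
  %-progression-step a i e γ = begin
    ((a + i * γ) % m + (e * γ) % m) % m  ≡⟨ %-distribˡ-+ (a + i * γ) (e * γ) m ⟨
    (a + i * γ + e * γ) % m              ≡⟨ cong (_% m) (+-assoc a (i * γ) (e * γ)) ⟩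
    (a + (i * γ + e * γ)) % m            ≡⟨ cong (λ u → (a + u) % m) (*-distribʳ-+ γ i e) ⟨
    (a + (i + e) * γ) % m                ∎
    where open ≡-Reasoning

same-quotient⇒< : ∀ {x y G} .{{_ : NonZero G}} → x / G ≡ y / G → y < x + G
same-quotient⇒< {x} {y} {G} x/G≡y/G = begin-strict
  y                    ≡⟨ m≡m%n+[m/n]*n y G ⟩
  y % G + (y / G) * G  <⟨ +-monoˡ-< ((y / G) * G) (m%n<n y G) ⟩
  G + (y / G) * G      ≡⟨ cong (λ q → G + q * G) x/G≡y/G ⟨
  G + (x / G) * G      ≤⟨ +-monoʳ-≤ G (m/n*n≤m x G) ⟩
  G + x                ≡⟨ +-comm G x ⟩
  x + G                ∎
  where open ≤-Reasoning

module MiddleResidues {m B G : ℕ} .{{_ : NonZero m}} .{{_ : NonZero G}} (B+G≡m : B + G ≡ m) where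

  Middle : Pred ℕ 0ℓ
  Middle s = G ≤ s × s ≤ B

  close-sum⇒¬middle : ∀ {x z y} → x < m → z < m → (x + z) % m ≡ y → y < x + G → x < y + G → ¬ Middle z
  close-sum⇒¬middle {x} {z} {y} x<m z<m x+z≡y y<x+G x<y+G (G≤z , z≤B) with +-%-cases x<m z<m x+z≡y
  ... | inj₁ x+z≡y = <⇒≱ (+-cancelˡ-< x z G (subst (_< x + G) (sym x+z≡y) y<x+G)) G≤z
  ... | inj₂ x+z≡y+m = <⇒≱ B<z z≤B
    where
    B<z : B < z
    B<z = +-cancelˡ-< (y + G) B z (begin-strict
      y + G + B    ≡⟨ +-assoc y G B ⟩
      y + (G + B)  ≡⟨ cong (y +_) (trans (+-comm G B) B+G≡m) ⟩
      y + m        ≡⟨ x+z≡y+m ⟨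
      x + z        <⟨ +-monoˡ-< z x<y+G ⟩
      y + G + z    ∎)
      where open ≤-Reasoning

  multiples-not-all-middle : ∀ h γ → B < h * G → ¬ (∀ e → 1 ≤ e → e ≤ h → Middle ((e * γ) % m))
  multiples-not-all-middle h γ B<hG middle = collision (pigeonhole (n<1+n h) bin)
    where
    s : ℕ → ℕ
    s e = (e * γ) % m
    s≤B : ∀ e → e ≤ h → s e ≤ B
    s≤B zero _ = subst (_≤ B) (sym (m<n⇒m%n≡m (>-nonZero⁻¹ m))) z≤n
    s≤B e@(suc _) e≤h = proj₂ (middle e z<s e≤h)
    bin : Fin (suc h) → Fin h
    bin e = fromℕ< (m<n*o⇒m/o<n (≤-<-trans (s≤B (toℕ e) (s≤s⁻¹ (toℕ<n e))) B<hG))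
    collision : (∃₂ λ i j → i Fin.< j × bin i ≡ bin j) → ⊥
    collision (i , j , i<j , bin-i≡bin-j) =
      close-sum⇒¬middle (m%n<n _ m) (m%n<n _ m) sum≡ (same-quotient⇒< quot≡) (same-quotient⇒< (sym quot≡))
        (middle δ (m<n⇒0<n∸m i<j) (≤-trans (m∸n≤m (toℕ j) (toℕ i)) (s≤s⁻¹ (toℕ<n j))))
      where
      δ : ℕ
      δ = toℕ j ∸ toℕ i
      quot≡ : s (toℕ i) / G ≡ s (toℕ j) / G
      quot≡ = trans (sym (toℕ-fromℕ< _)) (trans (cong toℕ bin-i≡bin-j) (toℕ-fromℕ< _))
      sum≡ : (s (toℕ i) + s δ) % m ≡ s (toℕ j)
      sum≡ = trans (%-progression-step 0 (toℕ i) δ γ) (cong (λ e → (e * γ) % m) (m+[n∸m]≡n (<⇒≤ i<j)))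

  maximal-middle-term⇒middle-steps :
    ∀ h a γ → (∀ e → 1 ≤ e → e ≤ h → (e * γ) % m ≢ 0) → (a + h * γ) % m ≤ B
    → (∀ i → i ≤ h + h → (a + i * γ) % m ≤ (a + h * γ) % m)
    → ∀ e → 1 ≤ e → e ≤ h → Middle ((e * γ) % m)
  maximal-middle-term⇒middle-steps h a γ s≢0 M≤B maximal e 1≤e e≤h = G≤s , s≤B
    where
    M s : ℕ
    M = (a + h * γ) % m
    s = (e * γ) % m
    G≤s : G ≤ s
    G≤s = ≮⇒≥ λ s<G → <⇒≱ (M<later s<G) (maximal (h + e) (+-monoʳ-≤ h e≤h))
      where
      M<later : s < G → M < (a + (h + e) * γ) % m
      M<later s<G = begin-strict
        M                        <⟨ m<m+n M (n≢0⇒n>0 (s≢0 e 1≤e e≤h)) ⟩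
        M + s                    ≡⟨ m<n⇒m%n≡m (subst (M + s <_) B+G≡m (+-mono-≤-< M≤B s<G)) ⟨
        (M + s) % m              ≡⟨ %-progression-step a h e γ ⟩
        (a + (h + e) * γ) % m    ∎
        where open ≤-Reasoning
    s≤B : s ≤ B
    s≤B = ≮⇒≥ λ B<s → <⇒≱ (M<earlier B<s) (maximal (h ∸ e) (≤-trans (m∸n≤m h e) (m≤m+n h h)))
      where
      y : ℕ
      y = (a + (h ∸ e) * γ) % m
      y+s≡M : (y + s) % m ≡ M
      y+s≡M = trans (%-progression-step a (h ∸ e) e γ) (cong (λ i → (a + i * γ) % m) (m∸n+n≡m e≤h))
      M<earlier : B < s → M < y
      M<earlier B<s with +-%-cases (m%n<n _ m) (m%n<n _ m) y+s≡M
      ... | inj₁ y+s≡M = contradiction (≤-trans (subst (s ≤_) y+s≡M (m≤n+m s y)) M≤B) (<⇒≱ B<s)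
      ... | inj₂ y+s≡M+m = +-cancelʳ-< s M y (begin-strict
        M + s    <⟨ +-monoʳ-< M (m%n<n _ m) ⟩
        M + m    ≡⟨ y+s≡M+m ⟨
        y + s    ∎)
        where open ≤-Reasoning

  middle-term-not-maximal :
    ∀ h a γ → B < h * G → (∀ e → 1 ≤ e → e ≤ h → (e * γ) % m ≢ 0) → (a + h * γ) % m ≤ B
    → ¬ (∀ i → i ≤ h + h → (a + i * γ) % m ≤ (a + h * γ) % m)
  middle-term-not-maximal h a γ B<hG s≢0 M≤B maximal =
    multiples-not-all-middle h γ B<hG (maximal-middle-term⇒middle-steps h a γ s≢0 M≤B maximal)

primeFactors≥⇒rough : ∀ {q n} → (∀ p → Prime p → p ∣ n → q ≤ p) → q Rough n
primeFactors≥⇒rough {zero} _ = 0-rough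
primeFactors≥⇒rough {suc zero} _ = 1-rough
primeFactors≥⇒rough {suc (suc zero)} _ = 2-rough
primeFactors≥⇒rough {suc (suc (suc q))} {n} 2+q<p
  with 2+q-rough ← primeFactors≥⇒rough {suc (suc q)} {n} (λ p p-prime p∣n → <⇒≤ (2+q<p p p-prime p∣n))
     | 2 + q ∣? n
... | yes 2+q∣n = contradiction (2+q<p (2 + q) (rough∧∣⇒prime 2+q-rough 2+q∣n) 2+q∣n) (<-irrefl refl)
... | no 2+q∤n = ∤⇒rough-suc 2+q∤n 2+q-rough

rough⇒coprime : ∀ {q n e} → q Rough n → 0 < e → e < q → Coprime n e
rough⇒coprime _ 0<e _ {zero} (_ , 0∣e) = contradiction (0∣⇒≡0 0∣e) (≢-nonZero⁻¹ _ {{>-nonZero 0<e}})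
rough⇒coprime _ _ _ {suc zero} _ = refl
rough⇒coprime rough 0<e e<q {suc (suc _)} (d∣n , d∣e) =
  contradiction (hasNonTrivialDivisor (≤-<-trans (∣⇒≤ {{>-nonZero 0<e}} d∣e) e<q) d∣n) rough

rough⇒multiple%≢0 : ∀ {q n e γ} .{{_ : NonZero n}} → q Rough n → 0 < e → e < q → 0 < γ → γ < n → (e * γ) % n ≢ 0
rough⇒multiple%≢0 {_} {n} {e} {γ} rough 0<e e<q 0<γ γ<n eγ%n≡0 =
  <⇒≱ γ<n (∣⇒≤ {{>-nonZero 0<γ}} (coprime-divisor (rough⇒coprime rough 0<e e<q) (m%n≡0⇒n∣m (e * γ) n eγ%n≡0)))

bound*[1+h]≤h*m : ∀ h m → bound (suc (h * 2)) m * suc h ≤ h * m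
bound*[1+h]≤h*m h m = *-cancelʳ-≤ (B * suc h) (h * m) 2 (begin
  B * suc h * 2          ≡⟨ *-assoc B (suc h) 2 ⟩
  B * suc (suc (h * 2))  ≤⟨ m/n*n≤m (h * 2 * m) (suc (suc (h * 2))) ⟩
  h * 2 * m              ≡⟨ *-assoc h 2 m ⟩
  h * (2 * m)            ≡⟨ cong (h *_) (*-comm 2 m) ⟩
  h * (m * 2)            ≡⟨ *-assoc h m 2 ⟨
  h * m * 2              ∎)
  where
  open ≤-Reasoning
  B : ℕ
  B = bound (suc (h * 2)) m

bound<m : ∀ h m .{{_ : NonZero m}} → bound (suc (h * 2)) m < m
bound<m h m = *-cancelʳ-< (suc h) B m (begin-strict
  B * suc h      ≤⟨ bound*[1+h]≤h*m h m ⟩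
  h * m          <⟨ m<n+m (h * m) (>-nonZero⁻¹ m) ⟩
  m + h * m      ≡⟨ *-comm (suc h) m ⟩
  m * suc h      ∎)
  where
  open ≤-Reasoning
  B : ℕ
  B = bound (suc (h * 2)) m

bound<h*gap : ∀ h m .{{_ : NonZero m}} → ¬ (suc h ∣ m) → bound (suc (h * 2)) m < h * (m ∸ bound (suc (h * 2)) m)
bound<h*gap h m 1+h∤m = ≤∧≢⇒< B≤hG (λ B≡hG → 1+h∤m (divides G (m≡G*[1+h] B≡hG)))
  where
  B G : ℕ
  B = bound (suc (h * 2)) m
  G = m ∸ B
  B+G≡m : B + G ≡ m
  B+G≡m = m+[n∸m]≡n (<⇒≤ (bound<m h m))
  B≤hG : B ≤ h * G
  B≤hG = +-cancelʳ-≤ (h * B) B (h * G) (begin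
    B + h * B        ≡⟨ cong (B +_) (*-comm h B) ⟩
    B + B * h        ≡⟨ *-suc B h ⟨
    B * suc h        ≤⟨ bound*[1+h]≤h*m h m ⟩
    h * m            ≡⟨ cong (h *_) B+G≡m ⟨
    h * (B + G)      ≡⟨ *-distribˡ-+ h B G ⟩
    h * B + h * G    ≡⟨ +-comm (h * B) (h * G) ⟩
    h * G + h * B    ∎)
    where open ≤-Reasoning
  m≡G*[1+h] : B ≡ h * G → m ≡ G * suc h
  m≡G*[1+h] B≡hG = begin
    m                ≡⟨ B+G≡m ⟨
    B + G            ≡⟨ cong (_+ G) B≡hG ⟩
    h * G + G        ≡⟨ +-comm (h * G) G ⟩
    suc h * G        ≡⟨ *-comm (suc h) G ⟩
    G * suc h        ∎
    where open ≡-Reasoning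

module _ {A : Set} {P Q : Pred A 0ℓ} (P? : Decidable P) (Q? : Decidable Q) (P⊆Q : P ⊆ Q) where

  length-filter-mono-≤ : ∀ xs → length (filter P? xs) ≤ length (filter Q? xs)
  length-filter-mono-≤ [] = z≤n
  length-filter-mono-≤ (x ∷ xs) with P? x | Q? x
  ... | yes _ | yes _ = s≤s (length-filter-mono-≤ xs)
  ... | yes p | no ¬q = contradiction (P⊆Q p) ¬q
  ... | no _  | yes _ = m≤n⇒m≤1+n (length-filter-mono-≤ xs)
  ... | no _  | no _  = length-filter-mono-≤ xs

  length-filter-mono-< : ∀ xs → Any (λ x → Q x × ¬ P x) xs → length (filter P? xs) < length (filter Q? xs)
  length-filter-mono-< (x ∷ xs) any with P? x | Q? x | any
  ... | yes p | _     | here (_ , ¬p) = contradiction p ¬p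
  ... | no _  | yes _ | here _        = s≤s (length-filter-mono-≤ xs)
  ... | no _  | no ¬q | here (q , _)  = contradiction q ¬q
  ... | yes _ | yes _ | there any′    = s≤s (length-filter-mono-< xs any′)
  ... | yes p | no ¬q | there _       = contradiction (P⊆Q p) ¬q
  ... | no _  | yes _ | there any′    = m≤n⇒m≤1+n (length-filter-mono-< xs any′)
  ... | no _  | no _  | there any′    = length-filter-mono-< xs any′

count-< : ∀ {m n} {u w : Vecₘ m n} {d : Fin m} → (∀ j → u j ≡ d → w j ≡ d)
        → ∀ j → w j ≡ d → u j ≢ d → count u d < count w d
count-< {n = n} {u} {w} {d} u⊆w j wj≡d uj≢d =
  length-filter-mono-< (λ j → u j Fin.≟ d) (λ j → w j Fin.≟ d) (u⊆w _) (allFin n) (lose (∈-allFin j) (wj≡d , uj≢d))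

bounded∧no-maximum⇒empty : ∀ {P : Pred ℕ 0ℓ} m → (∀ {x} → P x → x < m)
                          → (∀ {x} → P x → ¬ (∀ {y} → P y → y ≤ x)) → ∀ {x} → ¬ P x
bounded∧no-maximum⇒empty {P} m P<m no-maximum = descend m (m≤n+m m _)
  where
  descend : ∀ fuel {x} → m ≤ x + fuel → ¬ P x
  descend zero {x} m≤x+0 Px = <⇒≱ (P<m Px) (subst (m ≤_) (+-identityʳ x) m≤x+0)
  descend (suc fuel) {x} m≤x+1+f Px = no-maximum Px λ {y} Py → ≮⇒≥ λ x<y →
    descend fuel (≤-trans m≤x+1+f (subst (_≤ y + fuel) (sym (+-suc x fuel)) (+-monoˡ-≤ fuel x<y))) Py

module Progression {m n : ℕ} .{{_ : NonZero m}} (h : ℕ) .{{_ : NonZero h}} (rough : suc (suc h) Rough m)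
  (v c : Vecₘ m n)
  (inS : ∀ i → i < suc (h * 2) → InS (Dset (suc (h * 2))) (suc (bound (suc (h * 2)) m)) (v ⊕ (i ⊙ c))) where

  k B G : ℕ
  k = suc (h * 2)
  B = bound k m
  G = m ∸ B

  instance
    G≢0 : NonZero G
    G≢0 = >-nonZero (m<n⇒0<n∸m (bound<m h m))

  open MiddleResidues {m} {B} {G} (m+[n∸m]≡n (<⇒≤ (bound<m h m)))

  row : ℕ → Vecₘ m n
  row i = v ⊕ (i ⊙ c)

  toℕ-row : ∀ i j → toℕ (row i j) ≡ (toℕ (v j) + i * toℕ (c j)) % m
  toℕ-row i j = begin
    toℕ (row i j)                    ≡⟨ toℕ-fromℕ< _ ⟩
    (a + toℕ (i ·ₘ c j)) % m         ≡⟨ cong (λ u → (a + u) % m) (toℕ-fromℕ< _) ⟩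
    (a + (i * γ) % m) % m            ≡⟨ cong (λ u → (u + (i * γ) % m) % m) (m<n⇒m%n≡m (toℕ<n (v j))) ⟨
    (a % m + (i * γ) % m) % m        ≡⟨ %-distribˡ-+ a (i * γ) m ⟨
    (a + i * γ) % m                  ∎
    where
    open ≡-Reasoning
    a γ : ℕ
    a = toℕ (v j)
    γ = toℕ (c j)

  row-constant-on-zero-column : ∀ i j → toℕ (c j) ≡ 0 → row i j ≡ v j
  row-constant-on-zero-column i j cj≡0 = toℕ-injective (begin
    toℕ (row i j)                    ≡⟨ toℕ-row i j ⟩
    (toℕ (v j) + i * toℕ (c j)) % m  ≡⟨ cong (λ γ → (toℕ (v j) + i * γ) % m) cj≡0 ⟩
    (toℕ (v j) + i * 0) % m          ≡⟨ cong (λ u → (toℕ (v j) + u) % m) (*-zeroʳ i) ⟩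
    (toℕ (v j) + 0) % m              ≡⟨ cong (_% m) (+-identityʳ (toℕ (v j))) ⟩
    toℕ (v j) % m                    ≡⟨ m<n⇒m%n≡m (toℕ<n (v j)) ⟩
    toℕ (v j)                        ∎)
    where open ≡-Reasoning

  Entry : Pred ℕ 0ℓ
  Entry x = ∃₂ λ i j → i < k × toℕ (c j) ≢ 0 × toℕ (row i j) ≡ x

  entry<m : ∀ {x} → Entry x → x < m
  entry<m (i , j , _ , _ , refl) = toℕ<n (row i j)

  h+h<k : h + h < k
  h+h<k = s≤s (≤-reflexive (trans (cong (h +_) (sym (+-identityʳ h))) (*-comm 2 h)))

  B<hG : B < h * G
  B<hG = bound<h*gap h m λ 1+h∣m →
    rough (hasNonTrivialDivisor {{n>1⇒nonTrivial (s≤s (>-nonZero⁻¹ h))}} ≤-refl 1+h∣m)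

  middle-row-misses-maximal-entry : ∀ {x} → (∀ {y} → Entry y → y ≤ x) → x ≤ B
                                  → ∀ j → toℕ (c j) ≢ 0 → toℕ (row h j) ≢ x
  middle-row-misses-maximal-entry {x} maximal x≤B j cj≢0 refl =
    middle-term-not-maximal h a γ B<hG steps≢0 (subst (_≤ B) (toℕ-row h j) x≤B) column-maximal
    where
    a γ : ℕ
    a = toℕ (v j)
    γ = toℕ (c j)
    steps≢0 : ∀ e → 1 ≤ e → e ≤ h → (e * γ) % m ≢ 0
    steps≢0 e 1≤e e≤h = rough⇒multiple%≢0 rough 1≤e (s≤s (m≤n⇒m≤1+n e≤h)) (n≢0⇒n>0 cj≢0) (toℕ<n (c j))
    column-maximal : ∀ i → i ≤ h + h → (a + i * γ) % m ≤ (a + h * γ) % m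
    column-maximal i i≤2h = subst₂ _≤_ (toℕ-row i j) (toℕ-row h j)
      (maximal (i , j , ≤-<-trans i≤2h h+h<k , cj≢0 , refl))

  entry-not-maximal : ∀ {x} → Entry x → ¬ (∀ {y} → Entry y → y ≤ x)
  entry-not-maximal (i , j , i<k , cj≢0 , refl) maximal =
    <-irrefl equal-counts (count-< middle-row⊆row-i j refl (λ eq → misses j cj≢0 (cong toℕ eq)))
    where
    d : Fin m
    d = row i j
    d∈D : toℕ d ≤ B
    d∈D = proj₁ (inS i i<k) j
    equal-counts : count (row h) d ≡ count (row i) d
    equal-counts = trans (proj₂ (inS h (≤-<-trans (m≤m+n h h) h+h<k)) d d∈D) (sym (proj₂ (inS i i<k) d d∈D))
    misses : ∀ j′ → toℕ (c j′) ≢ 0 → toℕ (row h j′) ≢ toℕ d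
    misses = middle-row-misses-maximal-entry maximal d∈D
    middle-row⊆row-i : ∀ j′ → row h j′ ≡ d → row i j′ ≡ d
    middle-row⊆row-i j′ row-h≡d with toℕ (c j′) ≟ 0
    ... | yes cj′≡0 = trans (row-constant-on-zero-column i j′ cj′≡0)
                        (trans (sym (row-constant-on-zero-column h j′ cj′≡0)) row-h≡d)
    ... | no cj′≢0 = contradiction (cong toℕ row-h≡d) (misses j′ cj′≢0)

  c-is-zero : IsZeroVec c
  c-is-zero j with toℕ (c j) ≟ 0
  ... | yes cj≡0 = cj≡0
  ... | no cj≢0 = contradiction (0 , j , z<s , cj≢0 , refl)
                    (bounded∧no-maximum⇒empty m entry<m entry-not-maximal)

no-progression : ∀ {m n} .{{_ : NonZero m}} h .{{_ : NonZero h}} → suc (suc h) Rough m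
               → ¬ HasAP {m} {n} (Dset (suc (h * 2))) (suc (bound (suc (h * 2)) m)) (suc (h * 2))
no-progression h rough (v , c , c≢0 , inS) = c≢0 (Progression.c-is-zero h rough v c inS)

3+2h≤2p⇒2+h≤p : ∀ h p → suc (h * 2) + 2 ≤ 2 * p → suc (suc h) ≤ p
3+2h≤2p⇒2+h≤p h p 3+2h≤2p = *-cancelˡ-< 2 (suc h) p (begin-strict
  2 * suc h          ≡⟨ *-comm 2 (suc h) ⟩
  suc h * 2          <⟨ n<1+n (suc h * 2) ⟩
  suc (suc h * 2)    ≡⟨ cong suc (+-comm 2 (h * 2)) ⟩
  suc (h * 2) + 2    ≤⟨ 3+2h≤2p ⟩
  2 * p              ∎)
  where open ≤-Reasoning

theorem2p2 : (m k n : ℕ) → .{{_ : NonZero m}} → 2 ≤ m → 5 ≤ k → k % 2 ≡ 1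
           → (∀ p → Prime p → p ∣ m → k + 2 ≤ 2 * p)
           → 1 ≤ n → suc (bound k m) ∣ n
           → ¬ HasAP {m} {n} (Dset k) (suc (bound k m)) k
theorem2p2 m k n _ 5≤k k%2≡1 k+2≤2p _ _ =
  subst (λ k → ¬ HasAP {m} {n} (Dset k) (suc (bound k m)) k) (sym k≡1+h*2)
    (no-progression h {{>-nonZero (m≥n⇒m/n>0 (≤-trans (s≤s (s≤s z≤n)) 5≤k))}} rough)
  where
  h : ℕ
  h = k / 2
  k≡1+h*2 : k ≡ suc (h * 2)
  k≡1+h*2 = trans (m≡m%n+[m/n]*n k 2) (cong (_+ h * 2) k%2≡1)
  rough : suc (suc h) Rough m
  rough = primeFactors≥⇒rough λ p p-prime p∣m →
    3+2h≤2p⇒2+h≤p h p (subst (λ k → k + 2 ≤ 2 * p) k≡1+h*2 (k+2≤2p p p-prime p∣m))
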